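{- Let $G$ be a $2$-connected graph, let $u$ and $v$ be vertices of $G$, and let $\mathcal{C}$ be a set of cycles of $G$. If the graph $\mathcal{P}_\mathcal{C}(G_{uv})$ is connected, then $\mathcal{C}$ spans the cycle space of $G$ (over $\mathbb{F}_2$, i.e. every cycle of $G$ is a symmetric difference of finitely many cycles of $\mathcal{C}$).
   Context: For a path $L$ and vertices $x,y$ on $L$, $L_{xy}$ denotes the subpath of $L$ joining $x$ and $y$. For vertices $u,v$ of a $2$-connected graph $G$, the $uv$ path graph $\mathcal{P}(G_{uv})$ has as vertices the paths in $G$ joining $u$ and $v$, where two such paths $S$ and $T$ are adjacent if $T$ is obtained from $S$ by replacing a subpath $S_{xy}$ of $S$ with a subpath $T_{xy}$ of $T$ internally disjoint from $S_{xy}$; in that case $S\cup T$ contains a unique cycle, namely $S\Delta T = S_{xy}\cup T_{xy}$ (here $F\Delta H$ is the subgraph induced by the edges in exactly one of $F,H$). For a set $\mathcal{C}$ of cycles of $G$, $\mathcal{P}_\mathcal{C}(G_{uv})$ is the spanning subgraph of $\mathcal{P}(G_{uv})$ in which adjacent paths $S,T$ of $\mathcal{P}(G_{uv})$ remain adjacent if and only if the unique cycle contained in $S\cup T$ belongs to $\mathcal{C}$. -}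

module Defs where

open import Data.Nat using (ℕ; _≤_)
open import Data.Fin using (Fin; _≟_)
open import Data.Bool using (Bool; true; false; _∧_; _∨_; _xor_)
open import Data.List using (List; []; _∷_; _++_; head; last; length; foldr)
open import Data.List.Membership.Propositional using (_∈_; _∉_)
open import Data.List.Relation.Unary.Unique.Propositional using (Unique)
open import Data.List.Relation.Unary.All using (All)
open import Data.Maybe using (just)
open import Data.Product using (Σ; ∃; _×_; _,_)
open import Data.Unit using (⊤)
open import Relation.Nullary using (¬_)
open import Relation.Nullary.Decidable using (⌊_⌋)
open import Relation.Binary.PropositionalEquality using (_≡_; _≢_)
open import Relation.Binary.Construct.Closure.ReflexiveTransitive using (Star)

record Graph : Set where
  field
    n     : ℕ
    adj   : Fin n → Fin n → Bool
    sym   : ∀ a b → adj a b ≡ adj b a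
    irrefl : ∀ a → adj a a ≡ false

module _ (G : Graph) where
  open Graph G

  Vertex : Set
  Vertex = Fin n

  Adj : Vertex → Vertex → Set
  Adj a b = adj a b ≡ true

  IsWalk : List Vertex → Set
  IsWalk []           = ⊤
  IsWalk (_ ∷ [])     = ⊤
  IsWalk (a ∷ b ∷ r)  = Adj a b × IsWalk (b ∷ r)

  record IsPath (a b : Vertex) (vs : List Vertex) : Set where
    field
      starts : head vs ≡ just a
      ends   : last vs ≡ just b
      walk   : IsWalk vs
      simple : Unique vs

  IsPathAvoiding : Vertex → Vertex → Vertex → List Vertex → Set
  IsPathAvoiding w a b vs = IsPath a b vs × w ∉ vs

  Connected : Set
  Connected = ∀ a b → ∃ λ vs → IsPath a b vs

  TwoConnected : Set
  TwoConnected = (3 ≤ n) × Connected ×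
    (∀ w a b → a ≢ w → b ≢ w → ∃ λ vs → IsPathAvoiding w a b vs)

  -- edge sets (subgraphs considered via their edges), as Bool-valued
  -- functions on ordered pairs of vertices
  EdgeSet : Set
  EdgeSet = Vertex → Vertex → Bool

  _≐_ : EdgeSet → EdgeSet → Set
  E ≐ F = ∀ x y → E x y ≡ F x y

  ∅ : EdgeSet
  ∅ _ _ = false

  _Δ_ : EdgeSet → EdgeSet → EdgeSet
  (E Δ F) x y = E x y xor F x y

  edge : Vertex → Vertex → EdgeSet
  edge a b x y = (⌊ x ≟ a ⌋ ∧ ⌊ y ≟ b ⌋) ∨ (⌊ x ≟ b ⌋ ∧ ⌊ y ≟ a ⌋)

  walkEdges : List Vertex → EdgeSet
  walkEdges []          = ∅
  walkEdges (_ ∷ [])    = ∅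
  walkEdges (a ∷ b ∷ r) x y = edge a b x y ∨ walkEdges (b ∷ r) x y

  cycleEdges : Vertex → List Vertex → EdgeSet
  cycleEdges x₀ r x y with last (x₀ ∷ r)
  ... | just z  = walkEdges (x₀ ∷ r) x y ∨ edge z x₀ x y
  ... | _       = false

  IsCycle : EdgeSet → Set
  IsCycle C = Σ Vertex λ x₀ → Σ (List Vertex) λ r →
    (2 ≤ length r) × IsWalk (x₀ ∷ r) × Unique (x₀ ∷ r) ×
    (∀ z → last (x₀ ∷ r) ≡ just z → Adj z x₀) ×
    (C ≐ cycleEdges x₀ r)

  IsCycleSet : (EdgeSet → Set) → Set
  IsCycleSet 𝒞 = ∀ D → 𝒞 D → IsCycle D

  _∈𝒞_ : EdgeSet → (EdgeSet → Set) → Set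
  C ∈𝒞 𝒞 = ∃ λ D → 𝒞 D × (D ≐ C)

  -- vertices of the u–v path graph
  record UVPath (u v : Vertex) : Set where
    constructor mkPath
    field
      verts  : List Vertex
      isPath : IsPath u v verts
  open UVPath public

  -- adjacency in 𝒫(G_uv): T is obtained from S by replacing the subpath
  -- S_xy = x P y by a subpath T_xy = x Q y internally disjoint from it
  PathAdj : ∀ {u v} → UVPath u v → UVPath u v → Set
  PathAdj S T = Σ (List Vertex) λ A → Σ Vertex λ x → Σ (List Vertex) λ P →
    Σ (List Vertex) λ Q → Σ Vertex λ y → Σ (List Vertex) λ B →
      (verts S ≡ A ++ x ∷ P ++ y ∷ B) ×
      (verts T ≡ A ++ x ∷ Q ++ y ∷ B) ×
      (∀ w → w ∈ Q → w ∉ P) ×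
      (verts S ≢ verts T)

  -- adjacency in 𝒫_𝒞(G_uv): additionally the unique cycle S Δ T lies in 𝒞
  PathAdj𝒞 : (EdgeSet → Set) → ∀ {u v} → UVPath u v → UVPath u v → Set
  PathAdj𝒞 𝒞 S T = PathAdj S T ×
    ((walkEdges (verts S) Δ walkEdges (verts T)) ∈𝒞 𝒞)

  PathGraphConnected : (EdgeSet → Set) → Vertex → Vertex → Set
  PathGraphConnected 𝒞 u v = ∀ (S T : UVPath u v) → Star (PathAdj𝒞 𝒞) S T

  SpansCycleSpace : (EdgeSet → Set) → Set
  SpansCycleSpace 𝒞 = ∀ C → IsCycle C →
    ∃ λ (Ds : List EdgeSet) → All (λ D → D ∈𝒞 𝒞) Ds × (foldr _Δ_ ∅ Ds ≐ C)

-- Any two u–v paths differ by a sum of cycles of 𝒞: telescope along a path joining them in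
-- 𝒫_𝒞(G_uv).  A cycle C through u is such a difference: enter C from v at some b ≠ u avoiding
-- u, and go from u round either arc of C to b and on to v.  A general cycle C is handled by
-- induction on the length of a "stick", a path from u meeting C only at its end a.  If a ≠ u,
-- 2-connectedness gives a path from u to C avoiding a, and hence an ear from some b ≠ a on C
-- to some ρ ≠ a on the stick.  Closing the ear through either arc of C between a and b gives
-- two cycles whose sum is C, both carrying the shorter stick from u to ρ.

module Submission where

open import Defs
open import Data.Bool using (true; false; T; _∨_; _∧_; _xor_)
open import Data.Bool.Properties
  using (xor-comm; xor-assoc; xor-same; xor-identityʳ; xor-annihilates-not; ∨-comm; T-∨; T-∧)
open import Data.Empty using (⊥; ⊥-elim)
open import Data.Fin using (_≟_)
open import Data.List using (List; []; _∷_; _++_; [_]; length; foldr; last)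
open import Data.List.Membership.Propositional using (_∈_; _∉_)
open import Data.List.Membership.Propositional.Properties using (∈-++⁺ˡ; ∈-++⁺ʳ; ∈-++⁻)
import Data.List.Membership.DecPropositional as DecMembership
open import Data.List.Relation.Unary.Any using (here; there)
open import Data.List.Relation.Unary.All using (All; []; _∷_; lookup)
import Data.List.Relation.Unary.All.Properties as All
open import Data.List.Relation.Unary.AllPairs using ([]; _∷_; tail)
open import Data.List.Relation.Unary.Unique.Propositional using (Unique)
import Data.List.Relation.Unary.Unique.Propositional.Properties as Unique
open import Data.List.Relation.Binary.Disjoint.Propositional using (Disjoint)
open import Data.List.Relation.Binary.Subset.Propositional using (_⊆_)
open import Data.List.Relation.Binary.Permutation.Propositional using (_↭_; ↭-refl; ↭-sym; ↭-trans; ↭⇒↭ₛ)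
open import Data.List.Relation.Binary.Permutation.Propositional.Properties
  using (∈-resp-↭; ++-comm; ++⁺ʳ; ∷↭∷ʳ)
import Data.List.Relation.Binary.Permutation.Setoid.Properties as Permutation
open import Data.Maybe using (just)
open import Data.Nat using (_<_; s≤s; z≤n)
open import Data.Nat.Induction using (<-wellFounded)
open import Data.Product using (∃; ∃₂; _×_; _,_; proj₁; proj₂)
import Data.Product as Product
open import Data.Sum using (_⊎_; inj₁; inj₂)
import Data.Sum as Sum
open import Function using (_∘_; Equivalence)
open import Induction.WellFounded using (Acc; acc)
open import Relation.Binary.Construct.Closure.ReflexiveTransitive using (Star; ε; _◅_)
open import Relation.Binary.PropositionalEquality
  using (_≡_; _≢_; refl; sym; trans; cong; cong₂; subst; setoid; module ≡-Reasoning)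
open import Relation.Nullary using (yes; no)
open import Relation.Nullary.Decidable using (⌊_⌋; toWitness)

open Equivalence using (to)

module _ {A : Set} where

  Unique-resp-↭ : {xs ys : List A} → xs ↭ ys → Unique xs → Unique ys
  Unique-resp-↭ xs↭ys = Permutation.Unique-resp-↭ (setoid A) (↭⇒↭ₛ xs↭ys)

  Unique-∷ : {x : A} {xs : List A} → x ∉ xs → Unique xs → Unique (x ∷ xs)
  Unique-∷ x∉ u = All.¬Any⇒All¬ _ x∉ ∷ u

  Unique-++⁻ : ∀ xs {ys : List A} → Unique (xs ++ ys) → Unique xs × Unique ys × Disjoint xs ys
  Unique-++⁻ []       u        = [] , u , λ ()
  Unique-++⁻ (x ∷ xs) (x∉ ∷ u) with Unique-++⁻ xs u
  ... | uxs , uys , xs#ys = All.++⁻ˡ xs x∉ ∷ uxs , uys , λ where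
    (here refl , z∈ys) → lookup (All.++⁻ʳ xs x∉) z∈ys refl
    (there z∈xs , z∈ys) → xs#ys (z∈xs , z∈ys)

  length-++-< : ∀ xs {ys : List A} {z} → z ∈ ys → length xs < length (xs ++ ys)
  length-++-< []       {_ ∷ _} _   = s≤s z≤n
  length-++-< (_ ∷ xs)         z∈ = s≤s (length-++-< xs z∈)

∨≡xor : ∀ p q → (T p → T q → ⊥) → p ∨ q ≡ p xor q
∨≡xor false q     _    = refl
∨≡xor true  false _    = refl
∨≡xor true  true  both = ⊥-elim (both _ _)

xor-cancelˡ : ∀ p q r → (p xor q) xor (p xor r) ≡ q xor r
xor-cancelˡ false q r = refl
xor-cancelˡ true  q r = xor-annihilates-not q r

xor-cancelʳ : ∀ p q r → (q xor p) xor (r xor p) ≡ q xor r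
xor-cancelʳ p q r = trans (cong₂ _xor_ (xor-comm q p) (xor-comm r p)) (xor-cancelˡ p q r)

xor-telescope : ∀ p q r → (p xor q) xor (q xor r) ≡ p xor r
xor-telescope p q r = trans (cong (_xor (q xor r)) (xor-comm p q)) (xor-cancelˡ q p r)

module _ (G : Graph) where

  private
    V : Set
    V = Vertex G

  open DecMembership (_≟_ {Graph.n G}) using (_∈?_)

  infixl 6 _⊕_
  _⊕_ : EdgeSet G → EdgeSet G → EdgeSet G
  _⊕_ = _Δ_ G

  infix 4 _≋_
  _≋_ : EdgeSet G → EdgeSet G → Set
  _≋_ = _≐_ G

  -- Walk a l b : the vertex sequence a ∷ l is a walk from a to b.
  Walk : V → List V → V → Set
  Walk a []      b = a ≡ b
  Walk a (c ∷ l) b = Adj G a c × Walk c l b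

  walkSum : V → List V → EdgeSet G
  walkSum a []      = ∅ G
  walkSum a (c ∷ l) = edge G a c ⊕ walkSum c l

  Adj-sym : ∀ {a b} → Adj G a b → Adj G b a
  Adj-sym {a} {b} = trans (Graph.sym G b a)

  edge-sym : ∀ a b → edge G a b ≋ edge G b a
  edge-sym a b i j = ∨-comm (⌊ i ≟ a ⌋ ∧ ⌊ j ≟ b ⌋) _

  Walk-++ : ∀ {a b c} l {m} → Walk a l b → Walk b m c → Walk a (l ++ m) c
  Walk-++ []      refl    w′ = w′
  Walk-++ (_ ∷ l) (e , w) w′ = e , Walk-++ l w w′

  walkSum-++ : ∀ {a b} l m → Walk a l b → walkSum a (l ++ m) ≋ walkSum a l ⊕ walkSum b m
  walkSum-++ []          m refl    i j = refl
  walkSum-++ {a} (c ∷ l) m (_ , w) i j =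
    trans (cong (edge G a c i j xor_) (walkSum-++ l m w i j))
          (sym (xor-assoc (edge G a c i j) _ _))

  end∈ : ∀ {a b} l → Walk a l b → b ∈ a ∷ l
  end∈ []      refl    = here refl
  end∈ (_ ∷ l) (_ , w) = there (end∈ l w)

  end∈-tail : ∀ {a b} l → Walk a l b → a ≢ b → b ∈ l
  end∈-tail []      refl    a≢b = ⊥-elim (a≢b refl)
  end∈-tail (_ ∷ l) (_ , w) _   = end∈ l w

  reverseWalk : V → List V → List V
  reverseWalk a []      = []
  reverseWalk a (c ∷ l) = reverseWalk c l ++ [ a ]

  Walk-reverse : ∀ {a b} l → Walk a l b → Walk b (reverseWalk a l) a
  Walk-reverse []      refl    = refl
  Walk-reverse (_ ∷ l) (e , w) = Walk-++ (reverseWalk _ l) (Walk-reverse l w) (Adj-sym e , refl)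

  reverseWalk-↭ : ∀ {a b} l → Walk a l b → b ∷ reverseWalk a l ↭ a ∷ l
  reverseWalk-↭ []          refl    = ↭-refl
  reverseWalk-↭ {a} (c ∷ l) (_ , w) =
    ↭-trans (++⁺ʳ [ a ] (reverseWalk-↭ l w)) (↭-sym (∷↭∷ʳ a (c ∷ l)))

  walkSum-reverse : ∀ {a b} l → Walk a l b → walkSum b (reverseWalk a l) ≋ walkSum a l
  walkSum-reverse []          refl    i j = refl
  walkSum-reverse {a} (c ∷ l) (_ , w) i j = begin
    walkSum _ (reverseWalk c l ++ [ a ]) i j
      ≡⟨ walkSum-++ (reverseWalk c l) [ a ] (Walk-reverse l w) i j ⟩
    walkSum _ (reverseWalk c l) i j xor (edge G c a i j xor false)
      ≡⟨ cong₂ _xor_ (walkSum-reverse l w i j) (trans (xor-identityʳ _) (edge-sym c a i j)) ⟩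
    walkSum c l i j xor edge G a c i j
      ≡⟨ xor-comm (walkSum c l i j) _ ⟩
    edge G a c i j xor walkSum c l i j ∎
    where open ≡-Reasoning

  Walk-split : ∀ {a b d} l → Walk a l b → d ∈ a ∷ l →
    ∃₂ λ l₁ l₂ → l ≡ l₁ ++ l₂ × Walk a l₁ d × Walk d l₂ b
  Walk-split l       w       (here refl) = [] , l , refl , refl , w
  Walk-split []      _       (there ())
  Walk-split (c ∷ l) (e , w) (there d∈) with Walk-split l w d∈
  ... | l₁ , l₂ , refl , w₁ , w₂ = c ∷ l₁ , l₂ , refl , (e , w₁) , w₂

  walkSum-⊕-sharedEnds : ∀ {x a b} pre m₁ m₂ suf → Walk x pre a → Walk a m₁ b → Walk a m₂ b →
    walkSum x (pre ++ m₁ ++ suf) ⊕ walkSum x (pre ++ m₂ ++ suf) ≋ walkSum a m₁ ⊕ walkSum a m₂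
  walkSum-⊕-sharedEnds {x} {a} {b} pre m₁ m₂ suf wpre w₁ w₂ i j =
    trans (cong₂ _xor_ (unfold m₁ w₁) (unfold m₂ w₂))
          (trans (xor-cancelˡ (walkSum x pre i j) _ _)
                 (xor-cancelʳ (walkSum b suf i j) (walkSum a m₁ i j) (walkSum a m₂ i j)))
    where
    unfold : ∀ m → Walk a m b →
      walkSum x (pre ++ m ++ suf) i j ≡ walkSum x pre i j xor (walkSum a m i j xor walkSum b suf i j)
    unfold m w = trans (walkSum-++ pre (m ++ suf) wpre i j)
                       (cong (walkSum x pre i j xor_) (walkSum-++ m suf w i j))

  Nontrivial : List V → Set
  Nontrivial l = ∀ w → ∃ λ z → z ∈ l × z ≢ w

  Nontrivial-intro : ∀ {a b l} → a ∈ l → b ∈ l → a ≢ b → Nontrivial l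
  Nontrivial-intro {a} {b} a∈ b∈ a≢b w with a ≟ w
  ... | yes refl = b , b∈ , a≢b ∘ sym
  ... | no a≢w   = a , a∈ , a≢w

  record Circuit (c : V) (l : List V) : Set where
    field
      closed     : Walk c l c
      distinct   : Unique l
      nontrivial : Nontrivial l

  record IsArc (a b : V) (l m : List V) : Set where
    field
      walk   : Walk a m b
      unique : Unique (a ∷ m)
      within : a ∷ m ⊆ l

  rotate : ∀ {c a} l → Walk c l c → a ∈ l →
    ∃ λ l′ → Walk a l′ a × l′ ↭ l × walkSum a l′ ≋ walkSum c l
  rotate {c} {a} l w a∈ with Walk-split l w (there a∈)
  ... | l₁ , l₂ , refl , w₁ , w₂ =
    l₂ ++ l₁ , Walk-++ l₂ w₂ w₁ , ++-comm l₂ l₁ ,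
    λ i j → trans (walkSum-++ l₂ l₁ w₂ i j)
                  (trans (xor-comm (walkSum a l₂ i j) _) (sym (walkSum-++ l₁ l₂ w₁ i j)))

  cycleArcs : ∀ {c a b l} → Circuit c l → a ∈ l → b ∈ l → a ≢ b →
    ∃₂ λ m₁ m₂ → IsArc a b l m₁ × IsArc a b l m₂ × walkSum a m₁ ⊕ walkSum a m₂ ≋ walkSum c l
  cycleArcs {c} {a} {b} {l} C a∈ b∈ a≢b with rotate l (Circuit.closed C) a∈
  ... | l′ , w′ , l′↭l , rotated with Walk-split l′ w′ (there (∈-resp-↭ (↭-sym l′↭l) b∈))
  ... | m₁ , m₂ , refl , w₁ , w₂ = m₁ , reverseWalk b m₂ , arc₁ , arc₂ , sum
    where
    parts = Unique-++⁻ m₁ (Unique-resp-↭ (↭-sym l′↭l) (Circuit.distinct C))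
    m₁#m₂ = proj₂ (proj₂ parts)
    a∈m₂ = end∈-tail m₂ w₂ (a≢b ∘ sym)
    b∈m₁ = end∈-tail m₁ w₁ a≢b
    back↭ = reverseWalk-↭ m₂ w₂
    arc₁ : IsArc a b l m₁
    arc₁ = record
      { walk   = w₁
      ; unique = Unique-∷ (λ a∈m₁ → m₁#m₂ (a∈m₁ , a∈m₂)) (proj₁ parts)
      ; within = λ { (here refl) → a∈ ; (there z∈) → ∈-resp-↭ l′↭l (∈-++⁺ˡ z∈) }
      }
    arc₂ : IsArc a b l (reverseWalk b m₂)
    arc₂ = record
      { walk   = Walk-reverse m₂ w₂
      ; unique = Unique-resp-↭ (↭-sym back↭)
                   (Unique-∷ (λ b∈m₂ → m₁#m₂ (b∈m₁ , b∈m₂)) (proj₁ (proj₂ parts)))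
      ; within = b∷m₂⊆l ∘ ∈-resp-↭ back↭
      }
      where
      b∷m₂⊆l : b ∷ m₂ ⊆ l
      b∷m₂⊆l (here refl) = b∈
      b∷m₂⊆l (there z∈)  = ∈-resp-↭ l′↭l (∈-++⁺ʳ m₁ z∈)
    sum : walkSum a m₁ ⊕ walkSum a (reverseWalk b m₂) ≋ walkSum c l
    sum i j = trans (cong (walkSum a m₁ i j xor_) (walkSum-reverse m₂ w₂ i j))
                    (trans (sym (walkSum-++ m₁ m₂ w₁ i j)) (rotated i j))

  record PathInto (L : List V) (x : V) (p : List V) (y : V) : Set where
    field
      walk    : Walk x p y
      unique  : Unique (x ∷ p)
      end∈L   : y ∈ L
      meetsAt : ∀ {z} → z ∈ x ∷ p → z ∈ L → z ≡ y

  firstVisit : ∀ L {x y} q → Walk x q y → Unique (x ∷ q) → y ∈ L →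
    ∃₂ λ p z → PathInto L x p z × x ∷ p ⊆ x ∷ q
  firstVisit L {x} q w u y∈ with x ∈? L
  ... | yes x∈ = [] , x , record
    { walk = refl ; unique = Unique-∷ (λ ()) [] ; end∈L = x∈ ; meetsAt = λ { (here refl) _ → refl } }
    , λ { (here refl) → here refl }
  firstVisit L []      refl    _        y∈ | no x∉ = ⊥-elim (x∉ y∈)
  firstVisit L (c ∷ q) (e , w) u@(_ ∷ uq) y∈ | no x∉ with firstVisit L q w uq y∈
  ... | p , z , into , p⊆q = c ∷ p , z , record
    { walk    = e , PathInto.walk into
    ; unique  = Unique-∷ (λ x∈ → Unique.Unique[x∷xs]⇒x∉xs u (p⊆q x∈)) (PathInto.unique into)
    ; end∈L   = PathInto.end∈L into
    ; meetsAt = λ { (here refl) x∈L → ⊥-elim (x∉ x∈L) ; (there z∈) → PathInto.meetsAt into z∈ }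
    }
    , λ { (here refl) → here refl ; (there z∈) → there (p⊆q z∈) }

  edge-ends : ∀ a b i j → T (edge G a b i j) → (i ≡ a × j ≡ b) ⊎ (i ≡ b × j ≡ a)
  edge-ends a b i j = Sum.map witnesses witnesses ∘ to T-∨
    where
    witnesses : ∀ {x y} → T (⌊ i ≟ x ⌋ ∧ ⌊ j ≟ y ⌋) → i ≡ x × j ≡ y
    witnesses {x} {y} = Product.map (toWitness {a? = i ≟ x}) (toWitness {a? = j ≟ y}) ∘ to T-∧

  edge-determines : ∀ {a b c} i j → a ≢ b → T (edge G a b i j) → T (edge G a c i j) → b ≡ c
  edge-determines {a} {b} {c} i j a≢b e e′ with edge-ends a b i j e | edge-ends a c i j e′
  ... | inj₁ (refl , refl) | inj₁ (_ , b≡c) = b≡c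
  ... | inj₁ (refl , refl) | inj₂ (_ , b≡a) = ⊥-elim (a≢b (sym b≡a))
  ... | inj₂ (refl , refl) | inj₁ (b≡a , _) = ⊥-elim (a≢b (sym b≡a))
  ... | inj₂ (refl , refl) | inj₂ (b≡c , _) = b≡c

  walkEdges-ends : ∀ l i j → T (walkEdges G l i j) → i ∈ l × j ∈ l
  walkEdges-ends []          _ _ ()
  walkEdges-ends (_ ∷ [])    _ _ ()
  walkEdges-ends (a ∷ c ∷ l) i j t =
    Sum.[ ends ∘ edge-ends a c i j , Product.map there there ∘ walkEdges-ends (c ∷ l) i j ] (to T-∨ t)
    where
    ends : (i ≡ a × j ≡ c) ⊎ (i ≡ c × j ≡ a) → i ∈ a ∷ c ∷ l × j ∈ a ∷ c ∷ l
    ends (inj₁ (refl , refl)) = here refl , there (here refl)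
    ends (inj₂ (refl , refl)) = there (here refl) , here refl

  walkEdges≋walkSum : ∀ a l → Unique (a ∷ l) → walkEdges G (a ∷ l) ≋ walkSum a l
  walkEdges≋walkSum a []      _ i j = refl
  walkEdges≋walkSum a (c ∷ l) u@(_ ∷ ucl) i j =
    trans (∨≡xor _ _ disjoint) (cong (edge G a c i j xor_) (walkEdges≋walkSum c l ucl i j))
    where
    disjoint : T (edge G a c i j) → T (walkEdges G (c ∷ l) i j) → ⊥
    disjoint e t with edge-ends a c i j e | walkEdges-ends (c ∷ l) i j t
    ... | inj₁ (refl , _) | i∈ , _ = Unique.Unique[x∷xs]⇒x∉xs u i∈
    ... | inj₂ (_ , refl) | _ , j∈ = Unique.Unique[x∷xs]⇒x∉xs u j∈

  Walk⇒IsWalk : ∀ {a b} l → Walk a l b → IsWalk G (a ∷ l)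
  Walk⇒IsWalk []      _       = _
  Walk⇒IsWalk (_ ∷ l) (e , w) = e , Walk⇒IsWalk l w

  Walk⇒last : ∀ {a b} l → Walk a l b → last (a ∷ l) ≡ just b
  Walk⇒last []      refl    = refl
  Walk⇒last (_ ∷ l) (_ , w) = Walk⇒last l w

  IsWalk⇒Walk : ∀ a l {b} → IsWalk G (a ∷ l) → last (a ∷ l) ≡ just b → Walk a l b
  IsWalk⇒Walk a []      _       refl = refl
  IsWalk⇒Walk a (c ∷ l) (e , w) eq   = e , IsWalk⇒Walk c l w eq

  last-just : ∀ (a : V) l → ∃ λ z → last (a ∷ l) ≡ just z
  last-just a []      = a , refl
  last-just a (c ∷ l) = last-just c l

  Walk⇒IsPath : ∀ {a b} l → Walk a l b → Unique (a ∷ l) → IsPath G a b (a ∷ l)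
  Walk⇒IsPath l w u =
    record { starts = refl ; ends = Walk⇒last l w ; walk = Walk⇒IsWalk l w ; simple = u }

  IsPath⇒Walk : ∀ {a b} vs → IsPath G a b vs → ∃ λ l → vs ≡ a ∷ l × Walk a l b × Unique (a ∷ l)
  IsPath⇒Walk []      record { starts = () }
  IsPath⇒Walk (a ∷ l) record { starts = refl ; ends = e ; walk = w ; simple = u } =
    l , refl , IsWalk⇒Walk a l w e , u

  cycleEdges-last : ∀ x₀ r {z} → last (x₀ ∷ r) ≡ just z →
    ∀ i j → cycleEdges G x₀ r i j ≡ (walkEdges G (x₀ ∷ r) i j ∨ edge G z x₀ i j)
  cycleEdges-last x₀ r eq i j with last (x₀ ∷ r)
  cycleEdges-last x₀ r refl i j | just _ = refl

  -- With at least two vertices after x₀, the closing edge z x₀ is not an edge of the walk x₀ ∷ r.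
  cycleEdges≋walkSum : ∀ x₀ c d r′ {z} → let r = c ∷ d ∷ r′ in
    IsWalk G (x₀ ∷ r) → Unique (x₀ ∷ r) → last (x₀ ∷ r) ≡ just z →
    cycleEdges G x₀ r ≋ walkSum x₀ (r ++ [ x₀ ])
  cycleEdges≋walkSum x₀ c d r′ {z} iw u@(_ ∷ ur) eq i j = begin
    cycleEdges G x₀ r i j                             ≡⟨ cycleEdges-last x₀ r eq i j ⟩
    walkEdges G (x₀ ∷ r) i j ∨ edge G z x₀ i j        ≡⟨ ∨≡xor _ _ disjoint ⟩
    walkEdges G (x₀ ∷ r) i j xor edge G z x₀ i j      ≡⟨ cong₂ _xor_ (walkEdges≋walkSum x₀ r u i j)
                                                                  (sym (xor-identityʳ _)) ⟩
    walkSum x₀ r i j xor walkSum z [ x₀ ] i j         ≡⟨ sym (walkSum-++ r [ x₀ ] w i j) ⟩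
    walkSum x₀ (r ++ [ x₀ ]) i j                      ∎
    where
    open ≡-Reasoning
    r = c ∷ d ∷ r′
    w : Walk x₀ r z
    w = IsWalk⇒Walk x₀ r iw eq
    x₀∉r = Unique.Unique[x∷xs]⇒x∉xs u
    disjoint : T (walkEdges G (x₀ ∷ r) i j) → T (edge G z x₀ i j) → ⊥
    disjoint t e with to T-∨ t
    ... | inj₁ e₀ = Unique.Unique[x∷xs]⇒x∉xs ur (subst (_∈ d ∷ r′) (sym c≡z) (end∈ r′ (proj₂ (proj₂ w))))
      where
      c≡z = edge-determines i j (x₀∉r ∘ here) e₀ (subst T (edge-sym z x₀ i j) e)
    ... | inj₂ t′ with edge-ends z x₀ i j e | walkEdges-ends r i j t′
    ...   | inj₁ (_ , refl) | _ , j∈ = x₀∉r j∈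
    ...   | inj₂ (refl , _) | i∈ , _ = x₀∉r i∈

  IsCycle⇒Circuit : ∀ {C} → IsCycle G C → ∃₂ λ c l → Circuit c l × C ≋ walkSum c l
  IsCycle⇒Circuit (x₀ , []          , ()     , _)
  IsCycle⇒Circuit (x₀ , _ ∷ []      , s≤s () , _)
  IsCycle⇒Circuit (x₀ , c ∷ d ∷ r′ , _ , iw , u , closing , C≐) with last-just x₀ (c ∷ d ∷ r′)
  ... | z , last≡z =
    x₀ , r ++ [ x₀ ] , circuit , λ i j → trans (C≐ i j) (cycleEdges≋walkSum x₀ c d r′ iw u last≡z i j)
    where
    r = c ∷ d ∷ r′
    circuit : Circuit x₀ (r ++ [ x₀ ])
    circuit = record
      { closed     = Walk-++ r (IsWalk⇒Walk x₀ r iw last≡z) (closing z last≡z , refl)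
      ; distinct   = Unique-resp-↭ (∷↭∷ʳ x₀ r) u
      ; nontrivial = Nontrivial-intro (∈-++⁺ʳ r (here refl)) (here refl)
                                      (Unique.Unique[x∷xs]⇒x∉xs u ∘ here)
      }

  module Span (𝒞 : EdgeSet G → Set) where

    ⨁ : List (EdgeSet G) → EdgeSet G
    ⨁ = foldr _⊕_ (∅ G)

    Spanned : EdgeSet G → Set
    Spanned E = ∃ λ Ds → All (λ D → _∈𝒞_ G D 𝒞) Ds × ⨁ Ds ≋ E

    ⨁-++ : ∀ Ds Es → ⨁ (Ds ++ Es) ≋ ⨁ Ds ⊕ ⨁ Es
    ⨁-++ []       Es i j = refl
    ⨁-++ (D ∷ Ds) Es i j = trans (cong (D i j xor_) (⨁-++ Ds Es i j)) (sym (xor-assoc (D i j) _ _))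

    spanned-∅ : Spanned (∅ G)
    spanned-∅ = [] , [] , λ _ _ → refl

    spanned-member : ∀ {D} → _∈𝒞_ G D 𝒞 → Spanned D
    spanned-member D∈𝒞 = _ ∷ [] , D∈𝒞 ∷ [] , λ _ _ → xor-identityʳ _

    spanned-resp : ∀ {E F} → E ≋ F → Spanned E → Spanned F
    spanned-resp E≋F (Ds , Ds∈𝒞 , ⨁Ds≋E) = Ds , Ds∈𝒞 , λ i j → trans (⨁Ds≋E i j) (E≋F i j)

    spanned-⊕ : ∀ {E F} → Spanned E → Spanned F → Spanned (E ⊕ F)
    spanned-⊕ (Ds , Ds∈𝒞 , ⨁Ds≋E) (Es , Es∈𝒞 , ⨁Es≋F) =
      Ds ++ Es , All.++⁺ Ds∈𝒞 Es∈𝒞 ,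
      λ i j → trans (⨁-++ Ds Es i j) (cong₂ _xor_ (⨁Ds≋E i j) (⨁Es≋F i j))

    pathGraph-spanned : ∀ {u v} {S T : UVPath G u v} → Star (PathAdj𝒞 G 𝒞) S T →
      Spanned (walkEdges G (verts S) ⊕ walkEdges G (verts T))
    pathGraph-spanned {S = S} ε = spanned-resp (λ i j → sym (xor-same (edgesOf S i j))) spanned-∅
      where edgesOf = walkEdges G ∘ verts
    pathGraph-spanned {S = S} {T} (_◅_ {j = R} (_ , S⊕R∈𝒞) R⋯T) =
      spanned-resp (λ i j → xor-telescope (edgesOf S i j) (edgesOf R i j) (edgesOf T i j))
        (spanned-⊕ (spanned-member S⊕R∈𝒞) (pathGraph-spanned R⋯T))
      where edgesOf = walkEdges G ∘ verts

  module _ (tc : TwoConnected G) where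

    approach : ∀ {L w x} → Nontrivial L → x ≢ w → ∃₂ λ p y → PathInto L x p y × w ∉ x ∷ p
    approach {L} {w} {x} nontrivial x≢w with nontrivial w
    ... | c , c∈ , c≢w with proj₂ (proj₂ tc) w x c x≢w c≢w
    ... | _ , isPath , w∉ with IsPath⇒Walk _ isPath
    ... | q , refl , walk , unique with firstVisit L q walk unique c∈
    ... | p , y , into , ⊆q = p , y , into , w∉ ∘ ⊆q

    module _ {u v : V} (u≢v : u ≢ v) (𝒞 : EdgeSet G → Set) (conn : PathGraphConnected G 𝒞 u v) where
      open Span 𝒞

      pathPair-spanned : ∀ {s t} → Walk u s v → Unique (u ∷ s) → Walk u t v → Unique (u ∷ t) →
        Spanned (walkSum u s ⊕ walkSum u t)
      pathPair-spanned {s} {t} ws us wt ut =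
        spanned-resp (λ i j → cong₂ _xor_ (walkEdges≋walkSum u s us i j) (walkEdges≋walkSum u t ut i j))
          (pathGraph-spanned (conn (mkPath _ (Walk⇒IsPath s ws us)) (mkPath _ (Walk⇒IsPath t wt ut))))

      -- Going from u round either arc of the cycle to b and then along q to v gives two u–v paths
      -- whose sum is the cycle.
      circuit-spanned-viaPath : ∀ {c l b q} → Circuit c l → u ∈ l → b ∈ l → u ≢ b →
        Walk b q v → Unique (b ∷ q) → (∀ {z} → z ∈ q → z ∉ l) → Spanned (walkSum c l)
      circuit-spanned-viaPath {l = l} {q = q} C u∈ b∈ u≢b wq uq q∩l=∅
        with cycleArcs C u∈ b∈ u≢b
      ... | m₁ , m₂ , arc₁ , arc₂ , arcsSum =
        spanned-resp
          (λ i j → trans (walkSum-⊕-sharedEnds [] m₁ m₂ q refl (IsArc.walk arc₁) (IsArc.walk arc₂) i j)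
                         (arcsSum i j))
          (pathPair-spanned (Walk-++ m₁ (IsArc.walk arc₁) wq) (simple arc₁)
                            (Walk-++ m₂ (IsArc.walk arc₂) wq) (simple arc₂))
        where
        simple : ∀ {m} → IsArc u _ l m → Unique (u ∷ m ++ q)
        simple arc = Unique.++⁺ (IsArc.unique arc) (tail uq)
                       (λ (z∈ , z∈q) → q∩l=∅ z∈q (IsArc.within arc z∈))

      circuitThrough-u-spanned : ∀ {c l} → Circuit c l → u ∈ l → Spanned (walkSum c l)
      circuitThrough-u-spanned {l = l} C u∈ with approach (Circuit.nontrivial C) (u≢v ∘ sym)
      ... | r , b , into , u∉ =
        circuit-spanned-viaPath C u∈ (PathInto.end∈L into) u≢b (Walk-reverse r (PathInto.walk into))
          unique′ q∩l=∅
        where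
        back↭ = reverseWalk-↭ r (PathInto.walk into)
        unique′ = Unique-resp-↭ (↭-sym back↭) (PathInto.unique into)
        u≢b : u ≢ b
        u≢b u≡b = u∉ (subst (_∈ v ∷ r) (sym u≡b) (end∈ r (PathInto.walk into)))
        q∩l=∅ : ∀ {z} → z ∈ reverseWalk v r → z ∉ l
        q∩l=∅ z∈ z∈l = Unique.Unique[x∷xs]⇒x∉xs unique′
          (subst (_∈ reverseWalk v r) (PathInto.meetsAt into (∈-resp-↭ back↭ (there z∈)) z∈l) z∈)

      record Ear (l p : List V) (a : V) : Set where
        field
          foot tip   : V
          path       : List V
          walk       : Walk foot path tip
          unique     : Unique (foot ∷ path)
          foot∈      : foot ∈ l
          foot≢a     : foot ≢ a
          offCycle   : ∀ {z} → z ∈ path → z ∉ l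
          tip∈       : tip ∈ u ∷ p
          tip≢a      : tip ≢ a
          meetsStick : ∀ {z} → z ∈ path → z ∈ u ∷ p → z ≡ tip

      -- The ear is the last stretch, back from the cycle, of a path from u to the cycle avoiding a.
      earAlong : ∀ {l r b} p {a} → PathInto l u r b → a ∉ u ∷ r → Ear l p a
      earAlong {l} {r} {b} p {a} into a∉
        with firstVisit (u ∷ p) (reverseWalk u r) (Walk-reverse r (PathInto.walk into))
               (Unique-resp-↭ (↭-sym (reverseWalk-↭ r (PathInto.walk into))) (PathInto.unique into))
               (here refl)
      ... | s , ρ , toStick , ⊆back = record
        { foot       = b
        ; tip        = ρ
        ; path       = s
        ; walk       = PathInto.walk toStick
        ; unique     = PathInto.unique toStick
        ; foot∈      = PathInto.end∈L into
        ; foot≢a     = λ b≡a → a∉ (subst (_∈ u ∷ r) b≡a (end∈ r (PathInto.walk into)))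
        ; offCycle   = λ z∈ z∈l → Unique.Unique[x∷xs]⇒x∉xs (PathInto.unique toStick)
                         (subst (_∈ s) (PathInto.meetsAt into (⊆r (there z∈)) z∈l) z∈)
        ; tip∈       = PathInto.end∈L toStick
        ; tip≢a      = λ ρ≡a → a∉ (subst (_∈ u ∷ r) ρ≡a (⊆r (end∈ s (PathInto.walk toStick))))
        ; meetsStick = PathInto.meetsAt toStick ∘ there
        }
        where
        ⊆r : b ∷ s ⊆ u ∷ r
        ⊆r = ∈-resp-↭ (reverseWalk-↭ r (PathInto.walk into)) ∘ ⊆back

      Lollipop : V → List V → List V → V → Set
      Lollipop c l p a = Circuit c l × PathInto l u p a

      findEar : ∀ {c l p a} → Lollipop c l p a → u ≢ a → Ear l p a
      findEar {p = p} (C , _) u≢a with approach (Circuit.nontrivial C) u≢a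
      ... | _ , _ , into , a∉ = earAlong p into a∉

      module ClosedEar {l a p₁ p₂ m} (stick : PathInto l u (p₁ ++ p₂) a) (e : Ear l (p₁ ++ p₂) a)
        (w₁ : Walk u p₁ (Ear.tip e)) (w₂ : Walk (Ear.tip e) p₂ a) (arc : IsArc a (Ear.foot e) l m) where
        private
          module S = PathInto stick
          module E = Ear e
          module A = IsArc arc
          parts = Unique-++⁻ (u ∷ p₁) S.unique
          p₁#p₂ = proj₂ (proj₂ parts)

        stick∉arc : ∀ {z} → z ∈ u ∷ p₁ ++ p₂ → z ∉ m
        stick∉arc z∈ z∈m = Unique.Unique[x∷xs]⇒x∉xs A.unique
                             (subst (_∈ m) (S.meetsAt z∈ (A.within (there z∈m))) z∈m)

        p₂∉arc : ∀ {z} → z ∈ p₂ → z ∉ m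
        p₂∉arc = stick∉arc ∘ ∈-++⁺ʳ (u ∷ p₁)

        p₂∉ear : ∀ {z} → z ∈ p₂ → z ∉ E.path
        p₂∉ear z∈p₂ z∈s =
          p₁#p₂ (end∈ p₁ w₁ , subst (_∈ p₂) (E.meetsStick z∈s (∈-++⁺ʳ (u ∷ p₁) z∈p₂)) z∈p₂)

        arc∉ear : ∀ {z} → z ∈ m → z ∉ E.path
        arc∉ear z∈m z∈s = E.offCycle z∈s (A.within (there z∈m))

        foot≢tip : E.foot ≢ E.tip
        foot≢tip b≡ρ = E.tip≢a (S.meetsAt E.tip∈ (subst (_∈ l) b≡ρ E.foot∈))

        circuit : Circuit E.tip (p₂ ++ m ++ E.path)
        circuit = record
          { closed     = Walk-++ p₂ w₂ (Walk-++ m A.walk E.walk)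
          ; distinct   = Unique.++⁺ (proj₁ (proj₂ parts))
                           (Unique.++⁺ (tail A.unique) (tail E.unique) (λ (z∈m , z∈s) → arc∉ear z∈m z∈s))
                           (λ (z∈p₂ , z∈ms) → Sum.[ p₂∉arc z∈p₂ , p₂∉ear z∈p₂ ] (∈-++⁻ m z∈ms))
          ; nontrivial = Nontrivial-intro (∈-++⁺ˡ (end∈-tail p₂ w₂ E.tip≢a))
                                          (∈-++⁺ʳ p₂ (∈-++⁺ˡ (end∈-tail m A.walk (E.foot≢a ∘ sym))))
                                          (E.foot≢a ∘ sym)
          }

        shortStick : PathInto (p₂ ++ m ++ E.path) u p₁ E.tip
        shortStick = record
          { walk    = w₁
          ; unique  = proj₁ parts
          ; end∈L   = ∈-++⁺ʳ p₂ (∈-++⁺ʳ m (end∈-tail E.path E.walk foot≢tip))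
          ; meetsAt = λ z∈ z∈D → Sum.[ (λ z∈p₂ → ⊥-elim (p₁#p₂ (z∈ , z∈p₂)))
                                     , Sum.[ ⊥-elim ∘ stick∉arc (∈-++⁺ˡ z∈)
                                           , (λ z∈s → E.meetsStick z∈s (∈-++⁺ˡ z∈)) ]
                                       ∘ ∈-++⁻ m ] (∈-++⁻ p₂ z∈D)
          }

        lollipop : Lollipop E.tip (p₂ ++ m ++ E.path) p₁ E.tip
        lollipop = circuit , shortStick

      shrink : ∀ {c l p a} → Lollipop c l p a → u ≢ a →
        ∃₂ λ ρ p₁ → length p₁ < length p × ∃₂ λ D₁ D₂ →
          Lollipop ρ D₁ p₁ ρ × Lollipop ρ D₂ p₁ ρ × walkSum ρ D₁ ⊕ walkSum ρ D₂ ≋ walkSum c l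
      shrink {p = p} L@(C , stick) u≢a with findEar L u≢a
      ... | e with Walk-split p (PathInto.walk stick) (Ear.tip∈ e)
      ... | p₁ , p₂ , refl , w₁ , w₂
        with cycleArcs C (PathInto.end∈L stick) (Ear.foot∈ e) (Ear.foot≢a e ∘ sym)
      ... | m₁ , m₂ , arc₁ , arc₂ , arcsSum =
        Ear.tip e , p₁ , length-++-< p₁ (end∈-tail p₂ w₂ (Ear.tip≢a e)) , _ , _ ,
        ClosedEar.lollipop stick e w₁ w₂ arc₁ , ClosedEar.lollipop stick e w₁ w₂ arc₂ ,
        λ i j → trans (walkSum-⊕-sharedEnds p₂ m₁ m₂ (Ear.path e) w₂ (IsArc.walk arc₁) (IsArc.walk arc₂) i j)
                      (arcsSum i j)

      lollipop-spanned : ∀ {c l p a} → Lollipop c l p a → Acc _<_ (length p) → Spanned (walkSum c l)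
      lollipop-spanned {a = a} L@(C , stick) (acc shorter) with u ≟ a
      ... | yes refl = circuitThrough-u-spanned C (PathInto.end∈L stick)
      ... | no u≢a with shrink L u≢a
      ... | _ , _ , p₁<p , _ , _ , L₁ , L₂ , sum =
        spanned-resp sum
          (spanned-⊕ (lollipop-spanned L₁ (shorter p₁<p)) (lollipop-spanned L₂ (shorter p₁<p)))

      circuit-spanned : ∀ {c l} → Circuit c l → Spanned (walkSum c l)
      circuit-spanned C with Circuit.nontrivial C u
      ... | y , y∈ , _ with proj₁ (proj₂ tc) u y
      ... | _ , isPath with IsPath⇒Walk _ isPath
      ... | q , refl , w , uq with firstVisit _ q w uq y∈
      ... | p , _ , stick , _ = lollipop-spanned (C , stick) (<-wellFounded (length p))

      spansCycleSpace : SpansCycleSpace G 𝒞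
      spansCycleSpace C isCycle with IsCycle⇒Circuit isCycle
      ... | _ , _ , circuit , C≋ = spanned-resp (λ i j → sym (C≋ i j)) (circuit-spanned circuit)

theorem3 : (G : Graph) → TwoConnected G →
    (u v : Vertex G) → u ≢ v →
    (𝒞 : EdgeSet G → Set) → IsCycleSet G 𝒞 →
    PathGraphConnected G 𝒞 u v → SpansCycleSpace G 𝒞
theorem3 G tc u v u≢v 𝒞 _ conn = spansCycleSpace G tc u≢v 𝒞 conn
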